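{- Let $n\ge2$. A non-empty $n$-colourable shift is not (topologically) mixing.
   Context: For a finite string $w$ over $\{0,1\}$, $\#w$ is its length, $\varepsilon$ the empty string; for $\#w\ge1$, $l(w)$ is $w$ without its last letter and $r(w)$ is $w$ without its first letter. $T^n$ is the alternating string of length $n$ starting with $0$ ($T^0=\varepsilon$, $T^n=T^{n-1}0$ for odd $n$, $T^n=T^{n-1}1$ for even $n\ge2$) and $CT^n$ its letterwise complement. $\xi$: $\xi(\varepsilon)=0$; $\xi(w)=1$ if $w=T^k$, $k\ge2$ even; $\xi(w)=-1$ if $w=CT^k$, $k\ge2$ even; otherwise $\xi(w)=\operatorname{sgn}(\xi(l(w))+\xi(r(w)))$. $\phi$: $\phi(\varepsilon)=0$; $\phi(w)=-1$ if $w=0^k$, $k$ odd; $\phi(w)=1$ if $w=1^k$, $k$ odd; otherwise $\phi(w)=\operatorname{sgn}(\phi(r(w))-\phi(l(w)))$. $\psi(w)=\xi(w)^{\#w}\phi(w)$ (with $0^0=1$); $w$ is colourable iff $\psi(w)\ne0$. For $n\ge2$, the maximal $n$-colourable shift is the subshift of finite type in $\{0,1\}^{\mathbb{N}}$ of all sequences none of whose length-$n$ factors is non-colourable; an $n$-colourable shift is any subshift of it. -}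

module Defs where

open import Data.Bool using (Bool; true; false; _∧_; not; if_then_else_)
open import Data.Bool.Properties using () renaming (_≟_ to _≟B_)
open import Data.Nat using (ℕ; zero; suc; _+_; _≤_)
open import Data.Integer using (ℤ; +_; -[1+_]; _-_; _^_) renaming (_+_ to _+ℤ_; _*_ to _*ℤ_)
open import Data.Fin using (Fin; toℕ)
open import Data.Vec using (Vec; []; _∷_; init; tail; tabulate; lookup)
open import Data.Product using (Σ; _×_; ∃)
open import Relation.Binary.PropositionalEquality using (_≡_; _≢_)
open import Relation.Nullary using (¬_; does)

-- Letters: false = 0, true = 1.  Words of length n: Vec Bool n.

sgn : ℤ → ℤ
sgn (+ zero)    = + 0
sgn (+ suc _)   = + 1
sgn -[1+ _ ]    = -[1+ 0 ]

evenB : ℕ → Bool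
evenB zero = true
evenB (suc n) = not (evenB n)

eqB : Bool → Bool → Bool
eqB a b = does (a ≟B b)

-- isAlt b w : w is the alternating word starting with letter b
-- (isAlt false w ⇔ w = T^k, isAlt true w ⇔ w = CT^k, k = length)
isAlt : ∀ {k} → Bool → Vec Bool k → Bool
isAlt b [] = true
isAlt b (x ∷ xs) = eqB x b ∧ isAlt (not b) xs

isConst : ∀ {k} → Bool → Vec Bool k → Bool
isConst b [] = true
isConst b (x ∷ xs) = eqB x b ∧ isConst b xs

-- ξ ; l = init, r = tail
ξ : ∀ n → Vec Bool n → ℤ
ξ zero [] = + 0
ξ (suc n) w =
  if evenB (suc n) ∧ isAlt false w then + 1
  else if evenB (suc n) ∧ isAlt true w then -[1+ 0 ]
  else sgn (ξ n (init w) +ℤ ξ n (tail w))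

φ : ∀ n → Vec Bool n → ℤ
φ zero [] = + 0
φ (suc n) w =
  if not (evenB (suc n)) ∧ isConst false w then -[1+ 0 ]
  else if not (evenB (suc n)) ∧ isConst true w then + 1
  else sgn (φ n (tail w) - φ n (init w))

-- ψ(w) = ξ(w)^{#w} φ(w)   (Data.Integer's _^_ has i ^ 0 = 1)
ψ : ∀ n → Vec Bool n → ℤ
ψ n w = (ξ n w ^ n) *ℤ φ n w

Colourable : ∀ n → Vec Bool n → Set
Colourable n w = ψ n w ≢ + 0

Seq : Set
Seq = ℕ → Bool

shift : Seq → Seq
shift x i = x (suc i)

shiftN : ℕ → Seq → Seq
shiftN m x i = x (m + i)

factor : Seq → ℕ → (n : ℕ) → Vec Bool n
factor x i n = tabulate (λ j → x (i + toℕ j))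

InCyl : ∀ {k} → Vec Bool k → Seq → Set
InCyl u x = ∀ j → x (toℕ j) ≡ lookup u j

MaxColourable : ℕ → Seq → Set
MaxColourable n x = ∀ i → Colourable n (factor x i n)

-- X is closed in the product topology on {0,1}^ℕ
Closed : (Seq → Set) → Set
Closed X = ∀ x → (∀ k → Σ Seq (λ y → X y × (∀ i → suc i ≤ k → y i ≡ x i))) → X x

IsSubshift : (Seq → Set) → Set
IsSubshift X = Closed X × (∀ x → X x → X (shift x))

NonEmpty : (Seq → Set) → Set
NonEmpty X = Σ Seq X

IsColourableShift : ℕ → (Seq → Set) → Set
IsColourableShift n X = IsSubshift X × (∀ x → X x → MaxColourable n x)

-- topological mixing, tested on the basic open sets (cylinders [u], [v]):
-- for all nonempty U = [u]∩X, V = [v]∩X, ∃N ∀m≥N, U ∩ σ^{-m} V ≠ ∅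
Mixing : (Seq → Set) → Set
Mixing X =
  ∀ {k l} (u : Vec Bool k) (v : Vec Bool l) →
  Σ Seq (λ x → X x × InCyl u x) →
  Σ Seq (λ y → X y × InCyl v y) →
  Σ ℕ (λ N → ∀ m → N ≤ m →
    Σ Seq (λ z → X z × InCyl u z × InCyl v (shiftN m z)))

module Submission where

-- A word w is colourable iff ψ(w) ≠ 0. The heart of the proof is that ψ alternates
-- along a sequence: if two consecutive factors of the same length are colourable, their
-- ψ-values are opposite. So in a sequence all of whose length-n factors are colourable,
-- a factor can only recur at even distance, whereas mixing, applied to the cylinder of
-- the initial n-block of a point of X, yields a point returning to it at an odd time 2N+1.
--
-- Alternation is a finite-state fact. The profile (φ(w), ξ(w), [w = 0ᵏ], [w = 1ᵏ],
-- [w = Tᵏ], [w = CTᵏ]) of a word takes finitely many values and is determined by the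
-- parity of #w and the profiles of l(w) and r(w). Hence the windows of three consecutive
-- profiles of same-length factors range over a finite set, obtained by saturating the
-- windows of length-1 factors under this rule, and alternation is checked on that set.

open import Defs
open import Data.Bool using (Bool; true; false; _∧_; not; if_then_else_)
import Data.Bool.Properties as Bool
open import Data.Integer
  using (ℤ; +_; -[1+_]; -_; _^_; 0ℤ; 1ℤ; -1ℤ) renaming (_+_ to _+ℤ_; _-_ to _-ℤ_; _*_ to _*ℤ_)
import Data.Integer.Properties as ℤ
open import Data.Fin using (Fin; toℕ; inject₁)
open import Data.Fin.Properties using (toℕ-inject₁)
open import Data.List using (List; []; _∷_; _++_; map; filter; cartesianProduct; cartesianProductWith; deduplicate)
import Data.List.Properties as List
open import Data.List.Relation.Unary.All using (All; all?)
import Data.List.Relation.Unary.All as All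
open import Data.List.Membership.Propositional.Properties
  using (∈-map⁺; ∈-filter⁺; ∈-cartesianProduct⁺; ∈-cartesianProductWith⁺; ∈-++⁺ˡ; ∈-++⁺ʳ; ∈-deduplicate⁺)
open import Data.List.Relation.Unary.Any using (here; there)
open import Data.List.Membership.Propositional using (_∈_)
open import Data.List.Relation.Binary.Subset.Propositional using (_⊆_)
open import Data.Nat using (ℕ; zero; suc; _+_; _≤_)
open import Data.Nat.GeneralisedArithmetic using (iterate)
open import Data.Nat.Properties using (+-suc; m≤m+n; n≤1+n; ≤-trans)
open import Data.Product using (_×_; _,_; proj₁; proj₂; uncurry)
open import Data.Product.Properties using (≡-dec)
open import Data.Sum using (_⊎_; inj₁; inj₂)
open import Data.Empty using (⊥-elim)
open import Data.Vec using (Vec; []; _∷_; init; tail; tabulate)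
open import Data.Vec.Properties using (tabulate-cong; lookup∘tabulate; tabulate∘lookup)
open import Function using (_∘_; id)
open import Relation.Binary.Definitions using (DecidableEquality)
open import Relation.Binary.PropositionalEquality
  using (_≡_; refl; sym; trans; cong; cong₂; subst; subst₂; module ≡-Reasoning)
open import Relation.Nullary using (¬_; Dec; yes; does)
open import Relation.Nullary.Decidable using (_×-dec_; _⊎-dec_)

Profile : Set
Profile = ℤ × ℤ × Bool × Bool × Bool × Bool

profile : ∀ {n} → Vec Bool n → Profile
profile {n} w = φ n w , ξ n w , isConst false w , isConst true w , isAlt false w , isAlt true w

combine : Bool → Profile → Profile → Profile
combine e (p , x , c₀ , c₁ , a₀ , a₁) (p′ , x′ , c₀′ , c₁′ , a₀′ , a₁′) =
  (if not e ∧ (c₀ ∧ c₀′) then -1ℤ else if not e ∧ (c₁ ∧ c₁′) then 1ℤ else sgn (p′ -ℤ p)) ,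
  (if e ∧ (a₀ ∧ a₁′) then 1ℤ else if e ∧ (a₁ ∧ a₀′) then -1ℤ else sgn (x +ℤ x′)) ,
  c₀ ∧ c₀′ , c₁ ∧ c₁′ , a₀ ∧ a₁′ , a₁ ∧ a₀′

isConst-init : ∀ b {k} (v : Vec Bool (suc k)) → isConst b v ≡ isConst b (init v) ∧ isConst b v
isConst-init b     (y ∷ [])          = refl
isConst-init false (false ∷ z ∷ zs) = isConst-init false (z ∷ zs)
isConst-init false (true  ∷ z ∷ zs) = refl
isConst-init true  (false ∷ z ∷ zs) = refl
isConst-init true  (true  ∷ z ∷ zs) = isConst-init true (z ∷ zs)

isConst-init-tail : ∀ b {k} (w : Vec Bool (suc (suc k))) →
                    isConst b w ≡ isConst b (init w) ∧ isConst b (tail w)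
isConst-init-tail b (y ∷ v) = begin
  eqB y b ∧ isConst b v                          ≡⟨ cong (eqB y b ∧_) (isConst-init b v) ⟩
  eqB y b ∧ (isConst b (init v) ∧ isConst b v)   ≡⟨ Bool.∧-assoc (eqB y b) _ _ ⟨
  (eqB y b ∧ isConst b (init v)) ∧ isConst b v   ∎
  where open ≡-Reasoning

isAlt-init : ∀ b {k} (v : Vec Bool (suc k)) → isAlt b v ≡ isAlt b (init v) ∧ isAlt b v
isAlt-init b     (y ∷ [])          = refl
isAlt-init false (false ∷ z ∷ zs) = isAlt-init true (z ∷ zs)
isAlt-init false (true  ∷ z ∷ zs) = refl
isAlt-init true  (false ∷ z ∷ zs) = refl
isAlt-init true  (true  ∷ z ∷ zs) = isAlt-init false (z ∷ zs)

isAlt-init-tail : ∀ b {k} (w : Vec Bool (suc (suc k))) →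
                  isAlt b w ≡ isAlt b (init w) ∧ isAlt (not b) (tail w)
isAlt-init-tail b (y ∷ v) = begin
  eqB y b ∧ isAlt (not b) v                                ≡⟨ cong (eqB y b ∧_) (isAlt-init (not b) v) ⟩
  eqB y b ∧ (isAlt (not b) (init v) ∧ isAlt (not b) v)     ≡⟨ Bool.∧-assoc (eqB y b) _ _ ⟨
  (eqB y b ∧ isAlt (not b) (init v)) ∧ isAlt (not b) v     ∎
  where open ≡-Reasoning

profile-init-tail : ∀ {k} (w : Vec Bool (suc (suc k))) →
                    profile w ≡ combine (evenB (suc (suc k))) (profile (init w)) (profile (tail w))
profile-init-tail w
  rewrite isConst-init-tail false w | isConst-init-tail true w
        | isAlt-init-tail false w | isAlt-init-tail true w = refl

IsSign : ℤ → Set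
IsSign i = i ≡ 0ℤ ⊎ i ≡ 1ℤ ⊎ i ≡ -1ℤ

sgn-sign : ∀ i → IsSign (sgn i)
sgn-sign (+ zero)  = inj₁ refl
sgn-sign (+ suc _) = inj₂ (inj₁ refl)
sgn-sign -[1+ _ ]  = inj₂ (inj₂ refl)

ξ-sign : ∀ n (w : Vec Bool n) → IsSign (ξ n w)
ξ-sign zero    []  = inj₁ refl
ξ-sign (suc n) w   = if-sign (evenB (suc n) ∧ isAlt false w) (evenB (suc n) ∧ isAlt true w) _
  where
  if-sign : ∀ b c i → IsSign (if b then 1ℤ else if c then -1ℤ else sgn i)
  if-sign true  _     _ = inj₂ (inj₁ refl)
  if-sign false true  _ = inj₂ (inj₂ refl)
  if-sign false false i = sgn-sign i

sign-cube : ∀ {i} → IsSign i → i *ℤ (i *ℤ i) ≡ i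
sign-cube (inj₁ refl)        = refl
sign-cube (inj₂ (inj₁ refl)) = refl
sign-cube (inj₂ (inj₂ refl)) = refl

sign-^ : ∀ {i} → IsSign i → ∀ n → i ^ suc n ≡ (if evenB (suc n) then i *ℤ i else i)
sign-^ {i} s zero = ℤ.^-identityʳ i
sign-^ {i} s (suc n) with evenB (suc n) | sign-^ s n
... | true  | eq = trans (cong (i *ℤ_) eq) (sign-cube s)
... | false | eq = cong (i *ℤ_) eq

ψᵖ : Bool → Profile → ℤ
ψᵖ e (p , x , _) = (if e then x *ℤ x else x) *ℤ p

ψ-profile : ∀ n (w : Vec Bool (suc n)) → ψ (suc n) w ≡ ψᵖ (evenB (suc n)) (profile w)
ψ-profile n w = cong (_*ℤ φ (suc n) w) (sign-^ (ξ-sign (suc n) w) n)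

-- Checking `does p? ≡ true` by refl evaluates the decision much faster than solving
-- `True p?` by eta.
by-decision : ∀ {P : Set} (p? : Dec P) → does p? ≡ true → P
by-decision (yes p) _ = p

Window : Set
Window = Profile × Profile × Profile

_≟ᵖ_ : DecidableEquality Profile
_≟ᵖ_ = ≡-dec ℤ._≟_ (≡-dec ℤ._≟_ (≡-dec Bool._≟_ (≡-dec Bool._≟_ (≡-dec Bool._≟_ Bool._≟_))))

_≟ʷ_ : DecidableEquality Window
_≟ʷ_ = ≡-dec _≟ᵖ_ (≡-dec _≟ᵖ_ _≟ᵖ_)

Overlap : Window → Window → Set
Overlap (_ , b , c) (b′ , c′ , _) = b ≡ b′ × c ≡ c′

overlap? : ∀ t t′ → Dec (Overlap t t′)
overlap? (_ , b , c) (b′ , c′ , _) = (b ≟ᵖ b′) ×-dec (c ≟ᵖ c′)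

extend : Bool → Window → Window → Window
extend e (a , b , c) (_ , _ , d) = combine e a b , combine e b c , combine e c d

extensions : Bool → List Window → List Window
extensions e S = map (uncurry (extend e)) (filter (uncurry overlap?) (cartesianProduct S S))

extensions⁺ : ∀ e {S t t′} → t ∈ S → t′ ∈ S → Overlap t t′ → extend e t t′ ∈ extensions e S
extensions⁺ e t∈S t′∈S o =
  ∈-map⁺ (uncurry (extend e)) (∈-filter⁺ (uncurry overlap?) (∈-cartesianProduct⁺ t∈S t′∈S) o)

-- layer false and layer true hold the windows of factors of odd and of even length.
Layers : Set
Layers = List Window × List Window

layer : Bool → Layers → List Window
layer false = proj₁
layer true  = proj₂

grow : Layers → Layers
grow S = next false , next true
  where
  next : Bool → List Window
  next e = deduplicate _≟ʷ_ (layer e S ++ extensions e (layer (not e) S))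

grow-increasing : ∀ b S → layer b S ⊆ layer b (grow S)
grow-increasing false S = ∈-deduplicate⁺ _≟ʷ_ ∘ ∈-++⁺ˡ
grow-increasing true  S = ∈-deduplicate⁺ _≟ʷ_ ∘ ∈-++⁺ˡ

grow-extends : ∀ b S {t t′} → t ∈ layer b S → t′ ∈ layer b S → Overlap t t′ →
               extend (not b) t t′ ∈ layer (not b) (grow S)
grow-extends false S t∈S t′∈S o =
  ∈-deduplicate⁺ _≟ʷ_ (∈-++⁺ʳ (layer true S) (extensions⁺ true t∈S t′∈S o))
grow-extends true  S t∈S t′∈S o =
  ∈-deduplicate⁺ _≟ʷ_ (∈-++⁺ʳ (layer false S) (extensions⁺ false t∈S t′∈S o))

iterate-grow-increasing : ∀ n b S → layer b S ⊆ layer b (iterate grow S n)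
iterate-grow-increasing zero    b S = id
iterate-grow-increasing (suc n) b S = iterate-grow-increasing n b (grow S) ∘ grow-increasing b S

letterWindow : Bool → Bool → Bool → Window
letterWindow a b c = profile (a ∷ []) , profile (b ∷ []) , profile (c ∷ [])

letters : List Bool
letters = false ∷ true ∷ []

letter∈letters : ∀ a → a ∈ letters
letter∈letters false = here refl
letter∈letters true  = there (here refl)

letterWindows : List Window
letterWindows =
  cartesianProductWith (λ a → uncurry (letterWindow a)) letters (cartesianProduct letters letters)

reach : Layers
reach = iterate grow (letterWindows , []) 6

reach-fixed : grow reach ≡ reach
reach-fixed = by-decision (fixed? reach) refl
  where
  fixed? : (S : Layers) → Dec (grow S ≡ S)
  fixed? S = ≡-dec (List.≡-dec _≟ʷ_) (List.≡-dec _≟ʷ_) (grow S) S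

reach-letterWindow : ∀ a b c → letterWindow a b c ∈ layer false reach
reach-letterWindow a b c = iterate-grow-increasing 6 false (letterWindows , [])
  (∈-cartesianProductWith⁺ (λ a → uncurry (letterWindow a)) (letter∈letters a)
    (∈-cartesianProduct⁺ (letter∈letters b) (letter∈letters c)))

reach-extends : ∀ b {t t′} → t ∈ layer b reach → t′ ∈ layer b reach → Overlap t t′ →
                extend (not b) t t′ ∈ layer (not b) reach
reach-extends b {t} {t′} t∈S t′∈S o =
  subst (λ S → extend (not b) t t′ ∈ layer (not b) S) reach-fixed (grow-extends b reach t∈S t′∈S o)

init-tabulate : ∀ {A : Set} {n} (f : Fin (suc n) → A) → init (tabulate f) ≡ tabulate (f ∘ inject₁)
init-tabulate {n = zero}  f = refl
init-tabulate {n = suc n} f = cong (f Fin.zero ∷_) (init-tabulate (f ∘ Fin.suc))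

factor-init : ∀ x i n → init (factor x i (suc n)) ≡ factor x i n
factor-init x i n = trans (init-tabulate (λ j → x (i + toℕ j)))
                          (tabulate-cong (λ j → cong (λ k → x (i + k)) (toℕ-inject₁ j)))

factor-tail : ∀ x i n → tail (factor x i (suc n)) ≡ factor x (suc i) n
factor-tail x i n = tabulate-cong (λ j → cong x (+-suc i (toℕ j)))

profile-factor : ∀ x k i → profile (factor x i (suc (suc k))) ≡
  combine (evenB (suc (suc k))) (profile (factor x i (suc k))) (profile (factor x (suc i) (suc k)))
profile-factor x k i = trans (profile-init-tail (factor x i (suc (suc k))))
  (cong₂ (combine (evenB (suc (suc k)))) (cong profile (factor-init x i (suc k)))
                                         (cong profile (factor-tail x i (suc k))))

window : Seq → ℕ → ℕ → Window
window x k i =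
  profile (factor x i k) , profile (factor x (suc i) k) , profile (factor x (suc (suc i)) k)

window-extend : ∀ x k i →
  window x (suc (suc k)) i ≡ extend (evenB (suc (suc k))) (window x (suc k) i) (window x (suc k) (suc i))
window-extend x k i = cong₂ _,_ (profile-factor x k i)
  (cong₂ _,_ (profile-factor x k (suc i)) (profile-factor x k (suc (suc i))))

window-reachable : ∀ k x i → window x (suc k) i ∈ layer (evenB (suc k)) reach
window-reachable zero    x i = reach-letterWindow (x (i + 0)) (x (suc i + 0)) (x (suc (suc i) + 0))
window-reachable (suc k) x i =
  subst (_∈ layer (evenB (suc (suc k))) reach) (sym (window-extend x k i))
    (reach-extends (evenB (suc k)) (window-reachable k x i) (window-reachable k x (suc i)) (refl , refl))

Alternates : ℤ → ℤ → Set
Alternates a b = a ≡ 0ℤ ⊎ b ≡ 0ℤ ⊎ b ≡ - a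

AlternatesOn : Bool → Window → Set
AlternatesOn e (s₀ , s₁ , _) = Alternates (ψᵖ e s₀) (ψᵖ e s₁)

alternatesOn? : ∀ e t → Dec (AlternatesOn e t)
alternatesOn? e (s₀ , s₁ , _) = (a ℤ.≟ 0ℤ) ⊎-dec (b ℤ.≟ 0ℤ) ⊎-dec (b ℤ.≟ - a)
  where
  a = ψᵖ e s₀
  b = ψᵖ e s₁

reach-alternates : ∀ e → All (AlternatesOn e) (layer e reach)
reach-alternates false = by-decision (all? (alternatesOn? false) (layer false reach)) refl
reach-alternates true  = by-decision (all? (alternatesOn? true) (layer true reach)) refl

alternates-nonzero : ∀ {a b} → Alternates a b → ¬ a ≡ 0ℤ → ¬ b ≡ 0ℤ → b ≡ - a
alternates-nonzero (inj₁ a≡0)        a≢0 _   = ⊥-elim (a≢0 a≡0)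
alternates-nonzero (inj₂ (inj₁ b≡0)) _   b≢0 = ⊥-elim (b≢0 b≡0)
alternates-nonzero (inj₂ (inj₂ b≡-a)) _  _   = b≡-a

ψ-at : ℕ → Seq → ℕ → ℤ
ψ-at n x i = ψ n (factor x i n)

ψ-at-alternates : ∀ n x i → Colourable (suc n) (factor x i (suc n)) →
                  Colourable (suc n) (factor x (suc i) (suc n)) →
                  ψ-at (suc n) x (suc i) ≡ - ψ-at (suc n) x i
ψ-at-alternates n x i = alternates-nonzero
  (subst₂ Alternates (sym (ψ-profile n (factor x i (suc n))))
                     (sym (ψ-profile n (factor x (suc i) (suc n))))
    (All.lookup (reach-alternates (evenB (suc n))) (window-reachable n x i)))

module _ {n} (x : Seq) (colourable : MaxColourable (suc n) x) where

  ψ-at-step : ∀ i → ψ-at (suc n) x (suc i) ≡ - ψ-at (suc n) x i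
  ψ-at-step i = ψ-at-alternates n x i (colourable i) (colourable (suc i))

  ψ-at-even : ∀ t → ψ-at (suc n) x (t + t) ≡ ψ-at (suc n) x 0
  ψ-at-even zero    = refl
  ψ-at-even (suc t) = begin
    ψ-at (suc n) x (suc t + suc t)     ≡⟨ cong (ψ-at (suc n) x ∘ suc) (+-suc t t) ⟩
    ψ-at (suc n) x (suc (suc (t + t))) ≡⟨ ψ-at-step (suc (t + t)) ⟩
    - ψ-at (suc n) x (suc (t + t))     ≡⟨ cong -_ (ψ-at-step (t + t)) ⟩
    - - ψ-at (suc n) x (t + t)         ≡⟨ ℤ.neg-involutive _ ⟩
    ψ-at (suc n) x (t + t)             ≡⟨ ψ-at-even t ⟩
    ψ-at (suc n) x 0                   ∎
    where open ≡-Reasoning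

  ψ-at-odd : ∀ t → ψ-at (suc n) x (suc (t + t)) ≡ - ψ-at (suc n) x 0
  ψ-at-odd t = trans (ψ-at-step (t + t)) (cong -_ (ψ-at-even t))

  factor-not-repeated-at-odd-distance : ∀ t → ¬ factor x (suc (t + t)) (suc n) ≡ factor x 0 (suc n)
  factor-not-repeated-at-odd-distance t repeated = colourable 0 (i≡-i⇒i≡0 (begin
    ψ-at (suc n) x 0               ≡⟨ cong (ψ (suc n)) repeated ⟨
    ψ-at (suc n) x (suc (t + t))   ≡⟨ ψ-at-odd t ⟩
    - ψ-at (suc n) x 0             ∎))
    where
    open ≡-Reasoning
    i≡-i⇒i≡0 : ∀ {i} → i ≡ - i → i ≡ 0ℤ
    i≡-i⇒i≡0 {+ zero} _ = refl

factor-cylinder : ∀ x k → InCyl (factor x 0 k) x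
factor-cylinder x k j = sym (lookup∘tabulate (λ j → x (toℕ j)) j)

cylinder-factor : ∀ {k} (u : Vec Bool k) x → InCyl u x → factor x 0 k ≡ u
cylinder-factor u x x∈[u] = trans (tabulate-cong x∈[u]) (tabulate∘lookup u)

corollary5p11 : (n : ℕ) → 2 ≤ n → (X : Seq → Set) →
    IsColourableShift n X → NonEmpty X → ¬ Mixing X
corollary5p11 zero    ()
corollary5p11 (suc n) _ X (_ , colourable) (x , x∈X) mixing =
  let u = factor x 0 (suc n)
      x∈[u] = factor-cylinder x (suc n)
      (N , returns) = mixing u u (x , x∈X , x∈[u]) (x , x∈X , x∈[u])
      (z , z∈X , z∈[u] , σᵐz∈[u]) = returns (suc (N + N)) (≤-trans (m≤m+n N N) (n≤1+n _))
  in factor-not-repeated-at-odd-distance z (colourable z z∈X) N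
       (trans (cylinder-factor u (shiftN (suc (N + N)) z) σᵐz∈[u]) (sym (cylinder-factor u z z∈[u])))
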